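{- Let $L$ be a finite lattice and $m$ a positive integer. Then the set of join-irreducible elements of $L^{[m]}$ equals $\{(j)_k : j \text{ join-irreducible in } L,\ k\in\{1,\dots,m\}\}$.
   Context: $L^{[m]}$ is the set of $m$-multichains $(x_1,\dots,x_m)$ with $x_1\le x_2\le\cdots\le x_m$ in $L$, ordered componentwise; it is a sublattice of $L^m$. For $j\in L$ and $k\in\{1,\dots,m\}$, $(j)_k=(\hat 0,\dots,\hat 0,j,\dots,j)$ denotes the multichain whose first $k-1$ entries are the bottom element $\hat 0$ and whose entries $k,\dots,m$ equal $j$. An element $w$ is join-irreducible if $w=\bigvee A$ implies $w\in A$ (in particular $\hat 0$ is not join-irreducible); in a finite lattice this means $w$ covers exactly one element. -}

module Defs where

open import Level using (Level; _⊔_)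
import Data.Nat
import Data.Nat.Properties
open import Data.Nat using (ℕ)
open import Data.Fin using (Fin; toℕ) renaming (_≤_ to _≤ᶠ_)
open import Data.List using (List; foldr)
open import Data.List.Relation.Unary.Any using (Any)
open import Data.Product using (Σ; ∃; _,_; proj₁; proj₂)
open import Relation.Nullary using (yes; no; contradiction)
open import Relation.Binary using (Rel)
open import Relation.Binary.Lattice.Bundles using (BoundedLattice)
import Relation.Binary.Lattice.Properties.JoinSemilattice as JSProps

IsFinite : ∀ {c ℓ} (A : Set c) → Rel A ℓ → Set (c ⊔ ℓ)
IsFinite A _≈_ = ∃ λ n → Σ (Fin n → A) λ f → ∀ x → ∃ λ i → f i ≈ x

-- Join-irreducibility, as in the paper: w = ⋁A (A a finite family) implies
-- w ∈ A.  ⋁ of a list is foldr _∨_ ⊥ (so ⋁ [] = ⊥ and ⊥ is not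
-- join-irreducible).
JoinIrreducible : ∀ {c ℓ} {A : Set c} (_≈_ : Rel A ℓ) (_∨_ : A → A → A) (⊥ : A)
                  → A → Set (c ⊔ ℓ)
JoinIrreducible _≈_ _∨_ ⊥ w =
  ∀ (xs : List _) → w ≈ foldr _∨_ ⊥ xs → Any (λ x → w ≈ x) xs

module Multichains {c ℓ₁ ℓ₂} (L : BoundedLattice c ℓ₁ ℓ₂) (m : ℕ) where
  open BoundedLattice L renaming (Carrier to C)
  private module P = JSProps joinSemilattice

  -- m-multichains x₁ ≤ … ≤ xₘ, indexed by Fin m (0-based).
  Multichain : Set (c ⊔ ℓ₂)
  Multichain = Σ (Fin m → C) λ x → ∀ {i j : Fin m} → i ≤ᶠ j → x i ≤ x j

  _≈ᵐ_ : Rel Multichain ℓ₁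
  x ≈ᵐ y = ∀ i → proj₁ x i ≈ proj₁ y i

  _∨ᵐ_ : Multichain → Multichain → Multichain
  x ∨ᵐ y = (λ i → proj₁ x i ∨ proj₁ y i) , λ i≤j → P.∨-monotonic (proj₂ x i≤j) (proj₂ y i≤j)

  ⊥ᵐ : Multichain
  ⊥ᵐ = (λ _ → ⊥) , λ _ → refl

  -- (j)_k : first k-1 entries ⊥, entries k..m equal to j.
  -- With 0-based k : Fin m, entry i is ⊥ iff toℕ i < toℕ k.
  entry : C → Fin m → Fin m → C
  entry j k i with toℕ i Data.Nat.<? toℕ k
  ... | yes _ = ⊥
  ... | no _ = j

  entry-mono : ∀ j k {i i′ : Fin m} → i ≤ᶠ i′ → entry j k i ≤ entry j k i′
  entry-mono j k {i} {i′} i≤i′ with toℕ i Data.Nat.<? toℕ k | toℕ i′ Data.Nat.<? toℕ k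
  ... | yes _ | yes _ = refl
  ... | yes _ | no _ = minimum j
  ... | no _ | no _ = refl
  ... | no ¬p | yes q = contradiction (Data.Nat.Properties.≤-<-trans i≤i′ q) ¬p

  ⟨_⟩_ : C → Fin m → Multichain
  ⟨ j ⟩ k = entry j k , entry-mono j k

module Submission where

open import Defs
open import Data.Nat using (ℕ; _≤_; _<?_)
open import Data.Nat.Properties using (<-irrefl; ≮⇒≥)
open import Data.Fin using (Fin; toℕ)
open import Data.List using (List; []; _∷_; foldr; map; allFin)
open import Data.List.Relation.Unary.Any using (here; there; satisfied)
import Data.List.Relation.Unary.Any as Any
open import Data.List.Relation.Unary.Any.Properties using (map⁻)
open import Data.List.Membership.Propositional using (_∈_; find; lose)
open import Data.List.Membership.Propositional.Properties using (∈-map⁺; ∈-map⁻; ∈-allFin)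
open import Data.Product using (∃; ∃₂; _×_; _,_; proj₁; proj₂)
open import Function.Bundles using (_⇔_; mk⇔)
open import Relation.Binary using (Rel; IsEquivalence)
open import Relation.Binary.Lattice.Bundles using (BoundedLattice)
open import Relation.Binary.PropositionalEquality as ≡ using (_≡_)
open import Relation.Nullary using (yes; no; contradiction)

-- Every multichain x is the join of the multichains (x_k)_k, so a
-- join-irreducible x equals one of them.  Conversely (j)_k is the least
-- multichain whose k-th entry lies above j, and j ↦ (j)_k preserves joins;
-- so decompositions of (j)_k into joins correspond to decompositions of j,
-- read off at the k-th entry.

JoinIrreducible-resp : ∀ {c ℓ} {A : Set c} {_≈_ : Rel A ℓ} {_∨_ : A → A → A} {⊥ : A} →
                       IsEquivalence _≈_ → ∀ w w′ → w ≈ w′ →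
                       JoinIrreducible _≈_ _∨_ ⊥ w → JoinIrreducible _≈_ _∨_ ⊥ w′
JoinIrreducible-resp isEq _ _ w≈w′ irr xs w′≈⋁xs =
  Any.map (trans (sym w≈w′)) (irr xs (trans w≈w′ w′≈⋁xs))
  where open IsEquivalence isEq

module JoinIrreducibleMultichains {c ℓ₁ ℓ₂} (L : BoundedLattice c ℓ₁ ℓ₂) (m : ℕ) where
  open BoundedLattice L renaming (_≤_ to _⊑_)
  open Multichains L m

  ⋁ : List Carrier → Carrier
  ⋁ = foldr _∨_ ⊥

  ⋁ᵐ : List Multichain → Multichain
  ⋁ᵐ = foldr _∨ᵐ_ ⊥ᵐ

  -- A record rather than a function, so that x and y can be inferred from a proof.
  infix 4 _≤ᵐ_
  record _≤ᵐ_ (x y : Multichain) : Set ℓ₂ where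
    constructor pointwise
    field at : ∀ i → proj₁ x i ⊑ proj₁ y i
  open _≤ᵐ_

  ≈ᵐ-isEquivalence : IsEquivalence _≈ᵐ_
  ≈ᵐ-isEquivalence = record
    { refl  = λ i → Eq.refl
    ; sym   = λ x≈y i → Eq.sym (x≈y i)
    ; trans = λ x≈y y≈z i → Eq.trans (x≈y i) (y≈z i)
    }

  ≤ᵐ-antisym : ∀ {x y} → x ≤ᵐ y → y ≤ᵐ x → x ≈ᵐ y
  ≤ᵐ-antisym x≤y y≤x i = antisym (at x≤y i) (at y≤x i)

  ⋁-upper : ∀ {x xs} → x ∈ xs → x ⊑ ⋁ xs
  ⋁-upper {xs = y ∷ ys} (here ≡.refl) = x≤x∨y y (⋁ ys)
  ⋁-upper {xs = y ∷ ys} (there x∈ys)  = trans (⋁-upper x∈ys) (y≤x∨y y (⋁ ys))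

  ⋁-least : ∀ {u} xs → (∀ {x} → x ∈ xs → x ⊑ u) → ⋁ xs ⊑ u
  ⋁-least []       _     = minimum _
  ⋁-least (x ∷ xs) below =
    ∨-least (below (here ≡.refl)) (⋁-least xs (λ x∈xs → below (there x∈xs)))

  ⋁ᵐ-component : ∀ xs i → proj₁ (⋁ᵐ xs) i ≡ ⋁ (map (λ z → proj₁ z i) xs)
  ⋁ᵐ-component []       i = ≡.refl
  ⋁ᵐ-component (x ∷ xs) i = ≡.cong (proj₁ x i ∨_) (⋁ᵐ-component xs i)

  ⋁ᵐ-upper : ∀ {y xs} → y ∈ xs → y ≤ᵐ ⋁ᵐ xs
  ⋁ᵐ-upper {y} {xs} y∈xs = pointwise λ i →
    ≡.subst (proj₁ y i ⊑_) (≡.sym (⋁ᵐ-component xs i))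
      (⋁-upper (∈-map⁺ (λ z → proj₁ z i) y∈xs))

  ⋁ᵐ-least : ∀ {x} xs → (∀ {y} → y ∈ xs → y ≤ᵐ x) → ⋁ᵐ xs ≤ᵐ x
  ⋁ᵐ-least {x} xs below = pointwise λ i →
    ≡.subst (_⊑ proj₁ x i) (≡.sym (⋁ᵐ-component xs i)) (⋁-least _ (componentBelow i))
    where
    componentBelow : ∀ i {z} → z ∈ map (λ y → proj₁ y i) xs → z ⊑ proj₁ x i
    componentBelow i z∈ with ∈-map⁻ (λ y → proj₁ y i) z∈
    ... | y , y∈xs , ≡.refl = at (below y∈xs) i

  ⟨⟩-at : ∀ j k → proj₁ (⟨ j ⟩ k) k ≡ j
  ⟨⟩-at j k with toℕ k <? toℕ k
  ... | yes k<k = contradiction k<k (<-irrefl ≡.refl)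
  ... | no _    = ≡.refl

  ⟨⟩-least : ∀ {j k y} → j ⊑ proj₁ y k → ⟨ j ⟩ k ≤ᵐ y
  ⟨⟩-least {j} {k} {y} j⊑yₖ = pointwise below
    where
    below : ∀ i → entry j k i ⊑ proj₁ y i
    below i with toℕ i <? toℕ k
    ... | yes _   = minimum _
    ... | no i≮k = trans j⊑yₖ (proj₂ y (≮⇒≥ i≮k))

  ⟨⟩-mono : ∀ {j j′} k → j ⊑ j′ → ⟨ j ⟩ k ≤ᵐ ⟨ j′ ⟩ k
  ⟨⟩-mono {j} {j′} k j⊑j′ = ⟨⟩-least (≡.subst (j ⊑_) (≡.sym (⟨⟩-at j′ k)) j⊑j′)

  ⟨⟩-cong : ∀ {j j′} k → j ≈ j′ → (⟨ j ⟩ k) ≈ᵐ (⟨ j′ ⟩ k)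
  ⟨⟩-cong k j≈j′ =
    ≤ᵐ-antisym (⟨⟩-mono k (reflexive j≈j′)) (⟨⟩-mono k (reflexive (Eq.sym j≈j′)))

  ⟨⟩-⋁ : ∀ k ys → (⟨ ⋁ ys ⟩ k) ≈ᵐ ⋁ᵐ (map (⟨_⟩ k) ys)
  ⟨⟩-⋁ k ys = ≤ᵐ-antisym (⟨⟩-least ⋁ys⊑) (⋁ᵐ-least _ ⟨y⟩≤)
    where
    ⋁ys⊑ : ⋁ ys ⊑ proj₁ (⋁ᵐ (map (⟨_⟩ k) ys)) k
    ⋁ys⊑ = ⋁-least ys λ {y} y∈ys →
      ≡.subst (_⊑ proj₁ (⋁ᵐ (map (⟨_⟩ k) ys)) k) (⟨⟩-at y k)
        (at (⋁ᵐ-upper (∈-map⁺ (⟨_⟩ k) y∈ys)) k)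
    ⟨y⟩≤ : ∀ {z} → z ∈ map (⟨_⟩ k) ys → z ≤ᵐ ⟨ ⋁ ys ⟩ k
    ⟨y⟩≤ z∈ with ∈-map⁻ (⟨_⟩ k) z∈
    ... | y , y∈ys , ≡.refl = ⟨⟩-mono k (⋁-upper y∈ys)

  principals : Multichain → List Multichain
  principals x = map (λ k → ⟨ proj₁ x k ⟩ k) (allFin m)

  ⋁ᵐ-principals : ∀ x → x ≈ᵐ ⋁ᵐ (principals x)
  ⋁ᵐ-principals x = ≤ᵐ-antisym (pointwise x≤) (⋁ᵐ-least _ ≤x)
    where
    x≤ : ∀ i → proj₁ x i ⊑ proj₁ (⋁ᵐ (principals x)) i
    x≤ i = ≡.subst (_⊑ proj₁ (⋁ᵐ (principals x)) i) (⟨⟩-at (proj₁ x i) i)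
             (at (⋁ᵐ-upper (∈-map⁺ (λ k → ⟨ proj₁ x k ⟩ k) (∈-allFin i))) i)
    ≤x : ∀ {z} → z ∈ principals x → z ≤ᵐ x
    ≤x z∈ with ∈-map⁻ (λ k → ⟨ proj₁ x k ⟩ k) z∈
    ... | k , _ , ≡.refl = ⟨⟩-least {proj₁ x k} {k} refl

  joinIrreducible⇒principal : ∀ x → JoinIrreducible _≈ᵐ_ _∨ᵐ_ ⊥ᵐ x →
                              ∃ λ k → x ≈ᵐ (⟨ proj₁ x k ⟩ k)
  joinIrreducible⇒principal x irr =
    satisfied (map⁻ (irr (principals x) (⋁ᵐ-principals x)))

  ⟨⟩-joinIrreducible⁻ : ∀ j k → JoinIrreducible _≈ᵐ_ _∨ᵐ_ ⊥ᵐ (⟨ j ⟩ k) →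
                        JoinIrreducible _≈_ _∨_ ⊥ j
  ⟨⟩-joinIrreducible⁻ j k irr ys j≈⋁ys =
    Any.map kthEntry (map⁻ (irr (map (⟨_⟩ k) ys) ⟨j⟩≈⋁ᵐ))
    where
    ⟨j⟩≈⋁ᵐ : (⟨ j ⟩ k) ≈ᵐ ⋁ᵐ (map (⟨_⟩ k) ys)
    ⟨j⟩≈⋁ᵐ i = Eq.trans (⟨⟩-cong k j≈⋁ys i) (⟨⟩-⋁ k ys i)
    kthEntry : ∀ {y} → (⟨ j ⟩ k) ≈ᵐ (⟨ y ⟩ k) → j ≈ y
    kthEntry {y} ⟨j⟩≈⟨y⟩ = ≡.subst₂ _≈_ (⟨⟩-at j k) (⟨⟩-at y k) (⟨j⟩≈⟨y⟩ k)

  ⟨⟩-joinIrreducible⁺ : ∀ j k → JoinIrreducible _≈_ _∨_ ⊥ j →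
                        JoinIrreducible _≈ᵐ_ _∨ᵐ_ ⊥ᵐ (⟨ j ⟩ k)
  ⟨⟩-joinIrreducible⁺ j k irr xs ⟨j⟩≈⋁xs with find (map⁻ (irr _ j≈⋁xsₖ))
    where
    j≈⋁xsₖ : j ≈ ⋁ (map (λ y → proj₁ y k) xs)
    j≈⋁xsₖ = ≡.subst₂ _≈_ (⟨⟩-at j k) (⋁ᵐ-component xs k) (⟨j⟩≈⋁xs k)
  ... | y , y∈xs , j≈yₖ = lose y∈xs (≤ᵐ-antisym (⟨⟩-least (reflexive j≈yₖ)) y≤⟨j⟩)
    where
    y≤⟨j⟩ : y ≤ᵐ ⟨ j ⟩ k
    y≤⟨j⟩ = pointwise λ i →
      trans (at (⋁ᵐ-upper y∈xs) i) (reflexive (Eq.sym (⟨j⟩≈⋁xs i)))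

proposition5p1 : ∀ {c ℓ₁ ℓ₂} (L : BoundedLattice c ℓ₁ ℓ₂) →
    IsFinite (BoundedLattice.Carrier L) (BoundedLattice._≈_ L) →
    (m : ℕ) → 1 ≤ m →
    let open BoundedLattice L in
    let open Multichains L m in
    (x : Multichain) →
      JoinIrreducible _≈ᵐ_ _∨ᵐ_ ⊥ᵐ x
        ⇔ ∃₂ λ (j : Carrier) (k : Fin m) → JoinIrreducible _≈_ _∨_ ⊥ j × x ≈ᵐ (⟨ j ⟩ k)
proposition5p1 L _ m _ x = mk⇔ principalOfIrreducible irreducibleOfPrincipal
  where
  open BoundedLattice L
  open Multichains L m
  open JoinIrreducibleMultichains L m

  principalOfIrreducible : JoinIrreducible _≈ᵐ_ _∨ᵐ_ ⊥ᵐ x →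
    ∃₂ λ j k → JoinIrreducible _≈_ _∨_ ⊥ j × x ≈ᵐ (⟨ j ⟩ k)
  principalOfIrreducible irr with joinIrreducible⇒principal x irr
  ... | k , x≈⟨xₖ⟩ = proj₁ x k , k , ⟨⟩-joinIrreducible⁻ (proj₁ x k) k irrₖ , x≈⟨xₖ⟩
    where
    irrₖ : JoinIrreducible _≈ᵐ_ _∨ᵐ_ ⊥ᵐ (⟨ proj₁ x k ⟩ k)
    irrₖ = JoinIrreducible-resp ≈ᵐ-isEquivalence x (⟨ proj₁ x k ⟩ k) x≈⟨xₖ⟩ irr

  irreducibleOfPrincipal : (∃₂ λ j k → JoinIrreducible _≈_ _∨_ ⊥ j × x ≈ᵐ (⟨ j ⟩ k)) →
    JoinIrreducible _≈ᵐ_ _∨ᵐ_ ⊥ᵐ x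
  irreducibleOfPrincipal (j , k , irr , x≈⟨j⟩) =
    JoinIrreducible-resp ≈ᵐ-isEquivalence (⟨ j ⟩ k) x (λ i → Eq.sym (x≈⟨j⟩ i))
      (⟨⟩-joinIrreducible⁺ j k irr)
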